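{- Let $F=(f_1,\ldots,f_d)$ be a relative prime vector with $\prod_{i=1}^d f_i = n$. Then for all integers $x,y$: $R(x)=R(y)$ if and only if $x \equiv y \pmod n$, where $R$ denotes the residue vector with respect to $F$.
   Context: A relative prime vector is a vector of strictly positive integers $(f_1,\ldots,f_d)$ with $f_1\le \cdots\le f_d$ such that for any $1\le i,j\le d$ either $f_i=f_j$ or $f_i$ and $f_j$ are relatively prime. Given a relative prime vector $F=(f_1,\ldots,f_d)$ and an integer $x$, the residue vector of $x$ with respect to $F$ is $R(x)=(r_1(x),\ldots,r_d(x))$ with $r_i(x)=\lfloor x/f_i^{h}\rfloor \bmod f_i$, where $h:=\max\{i-j \mid f_j=f_i\}$ (i.e., $h$ is the number of indices $j<i$ with $f_j=f_i$). -}

module Defs where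

open import Data.Nat as ℕ using (ℕ; zero; suc; _^_; _<_; _≤_; _≟_)
open import Data.Nat.Coprimality using (Coprime)
open import Data.Integer as ℤ using (ℤ; _/ℕ_; _%ℕ_)
open import Data.Fin using (Fin; toℕ; _<?_)
open import Data.Fin.Properties using (all?)
open import Data.Vec using (Vec; lookup; tabulate; foldr)
open import Data.Vec.Functional using () renaming (Vector to FVec)
open import Data.Product using (_×_)
open import Data.Sum using (_⊎_)
open import Data.List using (List; length; filter)
open import Data.List.Base using (allFin)
open import Relation.Nullary using (Dec; yes; no; _×-dec_)
open import Relation.Binary.PropositionalEquality using (_≡_)

record RelPrimeVector {d : ℕ} (F : Vec ℕ d) : Set where
  field
    positive : ∀ i → 0 < lookup F i
    sorted   : ∀ i j → toℕ i ≤ toℕ j → lookup F i ≤ lookup F j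
    eqOrCop  : ∀ i j → lookup F i ≡ lookup F j ⊎ Coprime (lookup F i) (lookup F j)

prodVec : ∀ {d} → Vec ℕ d → ℕ
prodVec = foldr _ ℕ._*_ 1

hIndex : ∀ {d} → Vec ℕ d → Fin d → ℕ
hIndex {d} F i =
  length (filter (λ j → (j <? i) ×-dec (lookup F j ≟ lookup F i)) (allFin d))

-- floor division and (non-negative) remainder of an integer by a natural;
-- totalised with value 0 for divisor 0 (never used: entries are positive).
floorDiv : ℤ → ℕ → ℤ
floorDiv x zero    = ℤ.+ 0
floorDiv x (suc k) = x /ℕ suc k

modNat : ℤ → ℕ → ℕ
modNat x zero    = 0
modNat x (suc k) = x %ℕ suc k

residue : ∀ {d} → Vec ℕ d → ℤ → Fin d → ℕ
residue F x i = modNat (floorDiv x (lookup F i ^ hIndex F i)) (lookup F i)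

R : ∀ {d} → Vec ℕ d → ℤ → Vec ℕ d
R F x = tabulate (residue F x)

-- Split off the last entry v of F. If c of the earlier entries equal v, the
-- others are coprime to v, so the earlier entries multiply to v^c·m with m
-- coprime to v, and the last residue is ⌊x/v^c⌋ mod v. By induction the earlier
-- residues agree iff v^c·m ∣ x − y. In that case x − y = Q·v^c with
-- Q = ⌊x/v^c⌋ − ⌊y/v^c⌋ and m ∣ Q, and the last residues agree iff v ∣ Q. As m and
-- v are coprime, this means m·v ∣ Q, that is, v^c·m·v ∣ x − y.

module Submission where

open import Defs
open import Data.Nat using (ℕ)
open import Data.Integer using (ℤ; +_; _-_)
open import Data.Integer.Divisibility using (_∣_)
open import Data.Vec using (Vec)
open import Function.Bundles using (_⇔_)
open import Relation.Binary.PropositionalEquality using (_≡_)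

open import Level using (Level)
open import Data.Nat as ℕ using (zero; suc; _^_; _≟_; NonZero)
import Data.Nat.Properties as ℕ
import Data.Nat.Divisibility as ℕ
open import Data.Nat.DivMod using (m<n⇒m%n≡m)
open import Data.Nat.Coprimality as Coprime using (Coprime; coprime-divisor)
import Data.Nat.Tactic.RingSolver as ℕ-Solver
open import Data.Integer using (_+_; _*_; _/ℕ_; _%ℕ_; ∣_∣)
import Data.Integer.Properties as ℤ
open import Data.Integer.DivMod using (a≡a%ℕn+[a/ℕn]*n; n%ℕd<d)
import Data.Integer.Divisibility.Signed as Signed
open import Data.Integer.Tactic.RingSolver using (solve-∀)
open import Data.Fin as Fin using (Fin; toℕ; inject₁; fromℕ; _<?_)
import Data.Fin.Properties as Fin
open import Data.List using (List; []; _∷_; _++_; [_]; length; filter; allFin)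
import Data.List as List
import Data.List.Properties as List
import Data.Vec as Vec
import Data.Vec.Properties as Vec
open import Data.Product using (∃; _,_; _×_; proj₁; proj₂)
open import Data.Product.Function.NonDependent.Propositional using (_×-⇔_)
open import Data.Sum using (_⊎_; inj₁; inj₂)
open import Data.Empty using (⊥-elim)
open import Function using (_∘_; id)
open import Function.Bundles using (mk⇔; Equivalence)
open import Function.Related.Propositional as Related using ()
open import Relation.Nullary using (¬_; Dec; yes; no; _×-dec_)
open import Relation.Unary using (Pred; Decidable)
open import Relation.Binary.PropositionalEquality
  using (refl; sym; trans; cong; cong₂; subst; _≗_; module ≡-Reasoning)

private
  variable
    ℓ : Level
    n : ℕ

tabulate-∷ʳ : ∀ {A : Set ℓ} (f : Fin (suc n) → A) →
              List.tabulate f ≡ List.tabulate (f ∘ inject₁) ++ [ f (fromℕ n) ]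
tabulate-∷ʳ {n = zero}  f = refl
tabulate-∷ʳ {n = suc n} f = cong (f Fin.zero ∷_) (tabulate-∷ʳ (f ∘ Fin.suc))

length-filter-map : ∀ {A B : Set} {P : Pred B ℓ} (P? : Decidable P) (f : A → B) (xs : List A) →
                    length (filter P? (List.map f xs)) ≡ length (filter (P? ∘ f) xs)
length-filter-map P? f []       = refl
length-filter-map P? f (x ∷ xs) with P? (f x)
... | yes _ = cong suc (length-filter-map P? f xs)
... | no  _ = length-filter-map P? f xs

count : ∀ {P : Pred (Fin n) ℓ} → Decidable P → ℕ
count {n = n} P? = length (filter P? (allFin n))

count-∷ʳ : ∀ {P : Pred (Fin (suc n)) ℓ} (P? : Decidable P) →
           count P? ≡ count (P? ∘ inject₁) ℕ.+ length (filter P? [ fromℕ n ])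
count-∷ʳ {n = n} P? = begin
  length (filter P? (List.tabulate id))
    ≡⟨ cong (length ∘ filter P?) (tabulate-∷ʳ id) ⟩
  length (filter P? (List.tabulate inject₁ ++ [ fromℕ n ]))
    ≡⟨ cong length (List.filter-++ P? (List.tabulate inject₁) [ fromℕ n ]) ⟩
  length (filter P? (List.tabulate inject₁) ++ filter P? [ fromℕ n ])
    ≡⟨ List.length-++ (filter P? (List.tabulate inject₁)) ⟩
  length (filter P? (List.tabulate inject₁)) ℕ.+ length (filter P? [ fromℕ n ])
    ≡⟨ cong (λ xs → length (filter P? xs) ℕ.+ length (filter P? [ fromℕ n ]))
            (List.map-tabulate id inject₁) ⟨
  length (filter P? (List.map inject₁ (allFin n))) ℕ.+ length (filter P? [ fromℕ n ])
    ≡⟨ cong (ℕ._+ length (filter P? [ fromℕ n ])) (length-filter-map P? inject₁ (allFin n)) ⟩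
  count (P? ∘ inject₁) ℕ.+ length (filter P? [ fromℕ n ]) ∎
  where open ≡-Reasoning

count-∷ʳ-accept : ∀ {P : Pred (Fin (suc n)) ℓ} (P? : Decidable P) →
                  P (fromℕ n) → count P? ≡ suc (count (P? ∘ inject₁))
count-∷ʳ-accept P? p = trans (count-∷ʳ P?)
  (trans (cong (λ xs → count (P? ∘ inject₁) ℕ.+ length xs) (List.filter-accept P? p))
         (ℕ.+-comm (count (P? ∘ inject₁)) 1))

count-∷ʳ-reject : ∀ {P : Pred (Fin (suc n)) ℓ} (P? : Decidable P) →
                  ¬ P (fromℕ n) → count P? ≡ count (P? ∘ inject₁)
count-∷ʳ-reject P? ¬p = trans (count-∷ʳ P?)
  (trans (cong (λ xs → count (P? ∘ inject₁) ℕ.+ length xs) (List.filter-reject P? ¬p))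
         (ℕ.+-identityʳ (count (P? ∘ inject₁))))

count-cong : ∀ {P Q : Pred (Fin n) ℓ} (P? : Decidable P) (Q? : Decidable Q) →
             (∀ i → P i → Q i) → (∀ i → Q i → P i) → count P? ≡ count Q?
count-cong {n = n} P? Q? P⇒Q Q⇒P =
  cong length (List.filter-≐ P? Q? ((λ {i} → P⇒Q i) , (λ {i} → Q⇒P i)) (allFin n))

∀-∷ʳ-⇔ : ∀ {P : Pred (Fin (suc n)) ℓ} → (∀ i → P i) ⇔ ((∀ i → P (inject₁ i)) × P (fromℕ n))
∀-∷ʳ-⇔ {n = n} = mk⇔ (λ ∀P → ∀P ∘ inject₁ , ∀P (fromℕ n))
                      (λ (∀Pinit , Plast) → ∀-∷ʳ ∀Pinit Plast)
  where
  ∀-∷ʳ : ∀ {n} {P : Pred (Fin (suc n)) ℓ} → (∀ i → P (inject₁ i)) → P (fromℕ n) → ∀ i → P i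
  ∀-∷ʳ {n = zero}  _     Plast Fin.zero    = Plast
  ∀-∷ʳ {n = suc n} ∀Pinit _     Fin.zero    = ∀Pinit Fin.zero
  ∀-∷ʳ {n = suc n} ∀Pinit Plast (Fin.suc i) = ∀-∷ʳ (∀Pinit ∘ Fin.suc) Plast i

≗-resp-⇔ : ∀ {A B : Set} {f f′ h h′ : A → B} → f ≗ f′ → h ≗ h′ → (f ≗ h) ⇔ (f′ ≗ h′)
≗-resp-⇔ f≗f′ h≗h′ = mk⇔ (λ f≗h i → trans (sym (f≗f′ i)) (trans (f≗h i) (h≗h′ i)))
                          (λ f′≗h′ i → trans (f≗f′ i) (trans (f′≗h′ i) (sym (h≗h′ i))))

tabulate-≡⇔≗ : ∀ {A : Set ℓ} {f h : Fin n → A} → (Vec.tabulate f ≡ Vec.tabulate h) ⇔ (f ≗ h)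
tabulate-≡⇔≗ {f = f} {h} = mk⇔
  (λ eq i → trans (sym (Vec.lookup∘tabulate f i))
                   (trans (cong (λ xs → Vec.lookup xs i) eq) (Vec.lookup∘tabulate h i)))
  Vec.tabulate-cong

∣-<⇒≡0 : ∀ {m k} .{{_ : NonZero k}} → k ℕ.∣ m → m ℕ.< k → m ≡ 0
∣-<⇒≡0 {m} {k} k∣m m<k = trans (sym (m<n⇒m%n≡m m<k)) (ℕ.n∣m⇒m%n≡0 m k k∣m)

coprime-*ˡ : ∀ {m k n} → Coprime m n → Coprime k n → Coprime (m ℕ.* k) n
coprime-*ˡ {m} {k} m⊥n k⊥n {d} (d∣mk , d∣n) = m⊥n (d∣m , d∣n)
  where
  d⊥k : Coprime d k
  d⊥k (e∣d , e∣k) = k⊥n (e∣k , ℕ.∣-trans e∣d d∣n)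
  d∣m : d ℕ.∣ m
  d∣m = coprime-divisor d⊥k (subst (d ℕ.∣_) (ℕ.*-comm m k) d∣mk)

coprime⇒∣×∣⇔*∣ : ∀ {m n k} → Coprime m n → (m ℕ.∣ k × n ℕ.∣ k) ⇔ m ℕ.* n ℕ.∣ k
coprime⇒∣×∣⇔*∣ {m} {n} m⊥n = mk⇔ to (λ mn∣k → ℕ.m*n∣⇒m∣ m n mn∣k , ℕ.m*n∣⇒n∣ m n mn∣k)
  where
  to : ∀ {k} → m ℕ.∣ k × n ℕ.∣ k → m ℕ.* n ℕ.∣ k
  to (ℕ.divides c refl , n∣cm) =
    subst (m ℕ.* n ℕ.∣_) (ℕ.*-comm m c)
      (ℕ.*-monoʳ-∣ m (coprime-divisor (Coprime.sym m⊥n) (subst (n ℕ.∣_) (ℕ.*-comm c m) n∣cm)))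

-≡[%ℕ-%ℕ]+[/ℕ-/ℕ]* : ∀ x y v .{{_ : NonZero v}} →
                     x - y ≡ (+ (x %ℕ v) - + (y %ℕ v)) + (x /ℕ v - y /ℕ v) * + v
-≡[%ℕ-%ℕ]+[/ℕ-/ℕ]* x y v = begin
  x - y
    ≡⟨ cong₂ _-_ (a≡a%ℕn+[a/ℕn]*n x v) (a≡a%ℕn+[a/ℕn]*n y v) ⟩
  (+ (x %ℕ v) + x /ℕ v * + v) - (+ (y %ℕ v) + y /ℕ v * + v)
    ≡⟨ regroup (+ (x %ℕ v)) (x /ℕ v) (+ (y %ℕ v)) (y /ℕ v) (+ v) ⟩
  (+ (x %ℕ v) - + (y %ℕ v)) + (x /ℕ v - y /ℕ v) * + v ∎
  where
  open ≡-Reasoning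
  regroup : ∀ r a s b w → (r + a * w) - (s + b * w) ≡ (r - s) + (a - b) * w
  regroup = solve-∀

%ℕ≡⇒-≡[/ℕ-/ℕ]* : ∀ x y v .{{_ : NonZero v}} → x %ℕ v ≡ y %ℕ v →
                 x - y ≡ (x /ℕ v - y /ℕ v) * + v
%ℕ≡⇒-≡[/ℕ-/ℕ]* x y v x%v≡y%v = begin
  x - y                                             ≡⟨ -≡[%ℕ-%ℕ]+[/ℕ-/ℕ]* x y v ⟩
  (+ (x %ℕ v) - + (y %ℕ v)) + Q * + v               ≡⟨ cong (λ r → (+ r - + (y %ℕ v)) + Q * + v) x%v≡y%v ⟩
  (+ (y %ℕ v) - + (y %ℕ v)) + Q * + v               ≡⟨ cong (_+ Q * + v) (ℤ.+-inverseʳ (+ (y %ℕ v))) ⟩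
  + 0 + Q * + v                                     ≡⟨ ℤ.+-identityˡ (Q * + v) ⟩
  Q * + v                                           ∎
  where
  open ≡-Reasoning
  Q : ℤ
  Q = x /ℕ v - y /ℕ v

∣-<⇒≡ : ∀ {r s v} → r ℕ.< v → s ℕ.< v → + v ∣ + r - + s → r ≡ s
∣-<⇒≡ {r} {s} {v} r<v s<v v∣r-s =
  ℤ.+-injective (ℤ.i-j≡0⇒i≡j (+ r) (+ s) (ℤ.∣i∣≡0⇒i≡0 ∣r-s∣≡0))
  where
  instance
    v≢0 : NonZero v
    v≢0 = ℕ.>-nonZero (ℕ.≤-<-trans ℕ.z≤n r<v)
  ∣r-s∣<v : ∣ + r - + s ∣ ℕ.< v
  ∣r-s∣<v = subst (ℕ._< v) (cong ∣_∣ (sym (ℤ.m-n≡m⊖n r s)))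
              (ℕ.≤-<-trans (ℤ.∣m⊝n∣≤m⊔n r s) (ℕ.⊔-lub r<v s<v))
  ∣r-s∣≡0 : ∣ + r - + s ∣ ≡ 0
  ∣r-s∣≡0 = ∣-<⇒≡0 v∣r-s ∣r-s∣<v

∣⇒%ℕ≡ : ∀ x y v .{{_ : NonZero v}} → + v ∣ x - y → x %ℕ v ≡ y %ℕ v
∣⇒%ℕ≡ x y v v∣x-y = ∣-<⇒≡ (n%ℕd<d x v) (n%ℕd<d y v) (Signed.∣⇒∣ᵤ v∣r-s)
  where
  v∣Q*v : + v Signed.∣ (x /ℕ v - y /ℕ v) * + v
  v∣Q*v = Signed.∣n⇒∣m*n (x /ℕ v - y /ℕ v) Signed.∣-refl
  v∣r-s : + v Signed.∣ + (x %ℕ v) - + (y %ℕ v)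
  v∣r-s = Signed.∣m+n∣n⇒∣m
            (subst (+ v Signed.∣_) (-≡[%ℕ-%ℕ]+[/ℕ-/ℕ]* x y v) (Signed.∣ᵤ⇒∣ v∣x-y)) v∣Q*v

%ℕ≡⇔∣ : ∀ x y v .{{_ : NonZero v}} → (x %ℕ v ≡ y %ℕ v) ⇔ (+ v ∣ x - y)
%ℕ≡⇔∣ x y v =
  mk⇔ (Signed.∣⇒∣ᵤ {+ v} ∘ Signed.divides (x /ℕ v - y /ℕ v) ∘ %ℕ≡⇒-≡[/ℕ-/ℕ]* x y v)
      (∣⇒%ℕ≡ x y v)

∣⇒-≡[/ℕ-/ℕ]* : ∀ x y v .{{_ : NonZero v}} → + v ∣ x - y → x - y ≡ (x /ℕ v - y /ℕ v) * + v
∣⇒-≡[/ℕ-/ℕ]* x y v = %ℕ≡⇒-≡[/ℕ-/ℕ]* x y v ∘ ∣⇒%ℕ≡ x y v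

*-∣⇔∣ : ∀ {z} q M k .{{_ : NonZero M}} → z ≡ q * + M → (+ (M ℕ.* k) ∣ z) ⇔ (+ k ∣ q)
*-∣⇔∣ q M k refl = mk⇔ (ℕ.*-cancelˡ-∣ M ∘ subst (M ℕ.* k ℕ.∣_) ∣q*M∣≡M*∣q∣)
                        (subst (M ℕ.* k ℕ.∣_) (sym ∣q*M∣≡M*∣q∣) ∘ ℕ.*-monoʳ-∣ M)
  where
  ∣q*M∣≡M*∣q∣ : ∣ q * + M ∣ ≡ M ℕ.* ∣ q ∣
  ∣q*M∣≡M*∣q∣ = trans (ℤ.abs-* q (+ M)) (ℕ.*-comm ∣ q ∣ M)

∣×∣/ℕ⇔∣ : ∀ M m v .{{_ : NonZero M}} → Coprime m v → ∀ x y →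
          ((+ (M ℕ.* m) ∣ x - y) × (+ v ∣ x /ℕ M - y /ℕ M)) ⇔ (+ (M ℕ.* m ℕ.* v) ∣ x - y)
∣×∣/ℕ⇔∣ M m v m⊥v x y = mk⇔ to from
  where
  Q : ℤ
  Q = x /ℕ M - y /ℕ M
  x-y≡Q*M : ∀ k → + (M ℕ.* k) ∣ x - y → x - y ≡ Q * + M
  x-y≡Q*M k = ∣⇒-≡[/ℕ-/ℕ]* x y M ∘ ℕ.m*n∣⇒m∣ M k
  M[mv]⇔Mmv : ∀ z → (+ (M ℕ.* (m ℕ.* v)) ∣ z) ⇔ (+ (M ℕ.* m ℕ.* v) ∣ z)
  M[mv]⇔Mmv z = Related.≡⇒ (cong (λ k → + k ∣ z) (sym (ℕ.*-assoc M m v)))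

  to : (+ (M ℕ.* m) ∣ x - y) × (+ v ∣ Q) → + (M ℕ.* m ℕ.* v) ∣ x - y
  to (Mm∣x-y , v∣Q) = Equivalence.to (M[mv]⇔Mmv (x - y))
    (Equivalence.from (*-∣⇔∣ Q M (m ℕ.* v) eq)
      (Equivalence.to (coprime⇒∣×∣⇔*∣ m⊥v) (Equivalence.to (*-∣⇔∣ Q M m eq) Mm∣x-y , v∣Q)))
    where
    eq : x - y ≡ Q * + M
    eq = x-y≡Q*M m Mm∣x-y

  from : + (M ℕ.* m ℕ.* v) ∣ x - y → (+ (M ℕ.* m) ∣ x - y) × (+ v ∣ Q)
  from Mmv∣x-y = Equivalence.from (*-∣⇔∣ Q M m eq) (proj₁ m∣Q×v∣Q) , proj₂ m∣Q×v∣Q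
    where
    M[mv]∣x-y : + (M ℕ.* (m ℕ.* v)) ∣ x - y
    M[mv]∣x-y = Equivalence.from (M[mv]⇔Mmv (x - y)) Mmv∣x-y
    eq : x - y ≡ Q * + M
    eq = x-y≡Q*M (m ℕ.* v) M[mv]∣x-y
    m∣Q×v∣Q : (+ m ∣ Q) × (+ v ∣ Q)
    m∣Q×v∣Q = Equivalence.from (coprime⇒∣×∣⇔*∣ m⊥v)
                (Equivalence.to (*-∣⇔∣ Q M (m ℕ.* v) eq) M[mv]∣x-y)

prodVec-tabulate-∷ʳ : ∀ (g : Fin (suc n) → ℕ) →
                      prodVec (Vec.tabulate g) ≡ prodVec (Vec.tabulate (g ∘ inject₁)) ℕ.* g (fromℕ n)
prodVec-tabulate-∷ʳ {n = zero}  g = ℕ.*-comm (g Fin.zero) 1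
prodVec-tabulate-∷ʳ {n = suc n} g = trans
  (cong (g Fin.zero ℕ.*_) (prodVec-tabulate-∷ʳ (g ∘ Fin.suc)))
  (sym (ℕ.*-assoc (g Fin.zero) (prodVec (Vec.tabulate (g ∘ Fin.suc ∘ inject₁))) (g (fromℕ (suc n)))))

prodVec-tabulate≡^count-* : ∀ (g : Fin n → ℕ) v → (∀ j → g j ≡ v ⊎ Coprime (g j) v) →
  ∃ λ m → prodVec (Vec.tabulate g) ≡ v ^ count (λ j → g j ≟ v) ℕ.* m × Coprime m v
prodVec-tabulate≡^count-* {n = zero} g v _ = 1 , refl , Coprime.1-coprimeTo v
prodVec-tabulate≡^count-* {n = suc n} g v g≡v⊎g⊥v
  with prodVec-tabulate≡^count-* (g ∘ inject₁) v (g≡v⊎g⊥v ∘ inject₁)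
     | g (fromℕ n) ≟ v | g≡v⊎g⊥v (fromℕ n)
... | m , eq , m⊥v | yes w≡v | _ = m , prod≡ , m⊥v
  where
  open ≡-Reasoning
  c : ℕ
  c = count (λ j → g (inject₁ j) ≟ v)
  rotate : ∀ a m v → a ℕ.* m ℕ.* v ≡ v ℕ.* a ℕ.* m
  rotate = ℕ-Solver.solve-∀
  prod≡ : prodVec (Vec.tabulate g) ≡ v ^ count (λ j → g j ≟ v) ℕ.* m
  prod≡ = begin
    prodVec (Vec.tabulate g)                            ≡⟨ prodVec-tabulate-∷ʳ g ⟩
    prodVec (Vec.tabulate (g ∘ inject₁)) ℕ.* g (fromℕ n) ≡⟨ cong₂ ℕ._*_ eq w≡v ⟩
    v ^ c ℕ.* m ℕ.* v                                   ≡⟨ rotate (v ^ c) m v ⟩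
    v ^ suc c ℕ.* m
      ≡⟨ cong (λ k → v ^ k ℕ.* m) (count-∷ʳ-accept (λ j → g j ≟ v) w≡v) ⟨
    v ^ count (λ j → g j ≟ v) ℕ.* m                     ∎
... | m , eq , m⊥v | no w≢v | inj₁ w≡v = ⊥-elim (w≢v w≡v)
... | m , eq , m⊥v | no w≢v | inj₂ w⊥v = m ℕ.* g (fromℕ n) , prod≡ , coprime-*ˡ m⊥v w⊥v
  where
  open ≡-Reasoning
  w : ℕ
  w = g (fromℕ n)
  c : ℕ
  c = count (λ j → g (inject₁ j) ≟ v)
  prod≡ : prodVec (Vec.tabulate g) ≡ v ^ count (λ j → g j ≟ v) ℕ.* (m ℕ.* w)
  prod≡ = begin
    prodVec (Vec.tabulate g)                    ≡⟨ prodVec-tabulate-∷ʳ g ⟩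
    prodVec (Vec.tabulate (g ∘ inject₁)) ℕ.* w  ≡⟨ cong (ℕ._* w) eq ⟩
    v ^ c ℕ.* m ℕ.* w                           ≡⟨ ℕ.*-assoc (v ^ c) m w ⟩
    v ^ c ℕ.* (m ℕ.* w)
      ≡⟨ cong (λ k → v ^ k ℕ.* (m ℕ.* w)) (count-∷ʳ-reject (λ j → g j ≟ v) w≢v) ⟨
    v ^ count (λ j → g j ≟ v) ℕ.* (m ℕ.* w)     ∎

floorDiv≡/ℕ : ∀ x k .{{_ : NonZero k}} → floorDiv x k ≡ x /ℕ k
floorDiv≡/ℕ x (suc k) = refl

modNat≡%ℕ : ∀ x k .{{_ : NonZero k}} → modNat x k ≡ x %ℕ k
modNat≡%ℕ x (suc k) = refl

-- hIndex and residue for a family g : Fin n → ℕ; `residue F` is `residueᶠ (Vec.lookup F)`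
-- by definition, and the family form lets the induction split off the last entry.
hIndexᶠ : (Fin n → ℕ) → Fin n → ℕ
hIndexᶠ g i = count (λ j → (j <? i) ×-dec (g j ≟ g i))

residueᶠ : (Fin n → ℕ) → ℤ → Fin n → ℕ
residueᶠ g x i = modNat (floorDiv x (g i ^ hIndexᶠ g i)) (g i)

hIndexᶠ-inject₁ : ∀ (g : Fin (suc n) → ℕ) i → hIndexᶠ g (inject₁ i) ≡ hIndexᶠ (g ∘ inject₁) i
hIndexᶠ-inject₁ {n = n} g i = trans
  (count-∷ʳ-reject earlier (λ (last<i , _) → ℕ.≤⇒≯ (Fin.≤fromℕ (inject₁ i)) last<i))
  (count-cong (earlier ∘ inject₁) (λ j → (j <? i) ×-dec (g (inject₁ j) ≟ g (inject₁ i)))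
              (λ j (j<i , eq) → subst id (inject₁-< j) j<i , eq)
              (λ j (j<i , eq) → subst id (sym (inject₁-< j)) j<i , eq))
  where
  earlier : ∀ j → Dec ((j Fin.< inject₁ i) × (g j ≡ g (inject₁ i)))
  earlier j = (j <? inject₁ i) ×-dec (g j ≟ g (inject₁ i))
  inject₁-< : ∀ j → (inject₁ j Fin.< inject₁ i) ≡ (j Fin.< i)
  inject₁-< j = cong₂ ℕ._<_ (Fin.toℕ-inject₁ j) (Fin.toℕ-inject₁ i)

hIndexᶠ-fromℕ : ∀ (g : Fin (suc n) → ℕ) →
                hIndexᶠ g (fromℕ n) ≡ count (λ j → g (inject₁ j) ≟ g (fromℕ n))
hIndexᶠ-fromℕ {n = n} g = trans
  (count-∷ʳ-reject earlier (λ (last<last , _) → ℕ.<-irrefl refl last<last))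
  (count-cong (earlier ∘ inject₁) (λ j → g (inject₁ j) ≟ g (fromℕ n))
              (λ _ → proj₂) (λ j eq → inject₁<fromℕ j , eq))
  where
  earlier : ∀ j → Dec ((j Fin.< fromℕ n) × (g j ≡ g (fromℕ n)))
  earlier j = (j <? fromℕ n) ×-dec (g j ≟ g (fromℕ n))
  inject₁<fromℕ : ∀ j → inject₁ j Fin.< fromℕ n
  inject₁<fromℕ j = subst (toℕ (inject₁ j) ℕ.<_) (sym (Fin.toℕ-fromℕ n)) (Fin.inject₁ℕ< j)

residueᶠ-inject₁ : ∀ (g : Fin (suc n) → ℕ) x → residueᶠ g x ∘ inject₁ ≗ residueᶠ (g ∘ inject₁) x
residueᶠ-inject₁ g x i =
  cong (λ h → modNat (floorDiv x (g (inject₁ i) ^ h)) (g (inject₁ i))) (hIndexᶠ-inject₁ g i)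

residueᶠ-fromℕ : ∀ (g : Fin (suc n) → ℕ) x M .{{_ : NonZero (g (fromℕ n))}} .{{_ : NonZero M}} →
                 M ≡ g (fromℕ n) ^ count (λ j → g (inject₁ j) ≟ g (fromℕ n)) →
                 residueᶠ g x (fromℕ n) ≡ (x /ℕ M) %ℕ g (fromℕ n)
residueᶠ-fromℕ {n = n} g x M refl = begin
  modNat (floorDiv x (v ^ hIndexᶠ g (fromℕ n))) v
    ≡⟨ cong (λ h → modNat (floorDiv x (v ^ h)) v) (hIndexᶠ-fromℕ g) ⟩
  modNat (floorDiv x M) v                        ≡⟨ cong (λ q → modNat q v) (floorDiv≡/ℕ x M) ⟩
  modNat (x /ℕ M) v                              ≡⟨ modNat≡%ℕ (x /ℕ M) v ⟩
  (x /ℕ M) %ℕ v                                  ∎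
  where
  open ≡-Reasoning
  v : ℕ
  v = g (fromℕ n)

residueᶠ-≗⇔∣ : ∀ (g : Fin n → ℕ) → (∀ i → 0 ℕ.< g i) → (∀ i j → g i ≡ g j ⊎ Coprime (g i) (g j)) →
               ∀ x y → (residueᶠ g x ≗ residueᶠ g y) ⇔ (+ prodVec (Vec.tabulate g) ∣ x - y)
residueᶠ-≗⇔∣ {n = zero}  g _ _ x y = mk⇔ (λ _ → ℕ.1∣ ∣ x - y ∣) (λ _ ())
residueᶠ-≗⇔∣ {n = suc n} g g>0 g≡⊎⊥ x y = begin
  residueᶠ g x ≗ residueᶠ g y
    ∼⟨ ∀-∷ʳ-⇔ ⟩
  ((residueᶠ g x ∘ inject₁ ≗ residueᶠ g y ∘ inject₁) × (residueᶠ g x (fromℕ n) ≡ residueᶠ g y (fromℕ n)))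
    ∼⟨ ≗-resp-⇔ (residueᶠ-inject₁ g x) (residueᶠ-inject₁ g y)
       ×-⇔ Related.≡⇒ (cong₂ _≡_ (residueᶠ-fromℕ g x M refl) (residueᶠ-fromℕ g y M refl)) ⟩
  ((residueᶠ g′ x ≗ residueᶠ g′ y) × ((x /ℕ M) %ℕ v ≡ (y /ℕ M) %ℕ v))
    ∼⟨ residueᶠ-≗⇔∣ g′ (g>0 ∘ inject₁) (λ i j → g≡⊎⊥ (inject₁ i) (inject₁ j)) x y
       ×-⇔ %ℕ≡⇔∣ (x /ℕ M) (y /ℕ M) v ⟩
  ((+ prodVec (Vec.tabulate g′) ∣ x - y) × (+ v ∣ x /ℕ M - y /ℕ M))
    ≡⟨ cong (λ k → (+ k ∣ x - y) × (+ v ∣ x /ℕ M - y /ℕ M)) prod′≡M*m ⟩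
  ((+ (M ℕ.* m) ∣ x - y) × (+ v ∣ x /ℕ M - y /ℕ M))
    ∼⟨ ∣×∣/ℕ⇔∣ M m v m⊥v x y ⟩
  (+ (M ℕ.* m ℕ.* v) ∣ x - y)
    ≡⟨ cong (λ k → + (k ℕ.* v) ∣ x - y) prod′≡M*m ⟨
  (+ (prodVec (Vec.tabulate g′) ℕ.* v) ∣ x - y)
    ≡⟨ cong (λ k → + k ∣ x - y) (prodVec-tabulate-∷ʳ g) ⟨
  (+ prodVec (Vec.tabulate g) ∣ x - y) ∎
  where
  open Related.EquationalReasoning
  g′ : Fin n → ℕ
  g′ = g ∘ inject₁
  v M : ℕ
  v = g (fromℕ n)
  M = v ^ count (λ j → g′ j ≟ v)
  instance
    v≢0 : NonZero v
    v≢0 = ℕ.>-nonZero (g>0 (fromℕ n))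
    M≢0 : NonZero M
    M≢0 = ℕ.m^n≢0 v (count (λ j → g′ j ≟ v))
  factorisation : ∃ λ m → prodVec (Vec.tabulate g′) ≡ M ℕ.* m × Coprime m v
  factorisation = prodVec-tabulate≡^count-* g′ v (λ j → g≡⊎⊥ (inject₁ j) (fromℕ n))
  m : ℕ
  m = proj₁ factorisation
  prod′≡M*m : prodVec (Vec.tabulate g′) ≡ M ℕ.* m
  prod′≡M*m = proj₁ (proj₂ factorisation)
  m⊥v : Coprime m v
  m⊥v = proj₂ (proj₂ factorisation)

lemma2 : ∀ {d : ℕ} (F : Vec ℕ d) (n : ℕ) → RelPrimeVector F → prodVec F ≡ n →
         ∀ (x y : ℤ) → (R F x ≡ R F y) ⇔ (+ n ∣ (x - y))
lemma2 F n F-rel-prime refl x y = begin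
  R F x ≡ R F y                                ∼⟨ tabulate-≡⇔≗ ⟩
  residueᶠ (Vec.lookup F) x ≗ residueᶠ (Vec.lookup F) y
    ∼⟨ residueᶠ-≗⇔∣ (Vec.lookup F) positive eqOrCop x y ⟩
  (+ prodVec (Vec.tabulate (Vec.lookup F)) ∣ x - y)
    ≡⟨ cong (λ G → + prodVec G ∣ x - y) (Vec.tabulate∘lookup F) ⟩
  (+ prodVec F ∣ x - y)                        ∎
  where
  open Related.EquationalReasoning
  open RelPrimeVector F-rel-prime
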